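{- Let $q$ be a prime power and let $a,h,t$ be integers with $a \ge 0$, $h \ge 1$ and $t \ge 2$. Let $M$ be a matroid with a restriction $S$ that is a $(q,(a+1)h,t)$-stack, and let $X \subseteq E(M)$ satisfy $\sqcap_M(X,E(S)) \le a$. Then there exists $C \subseteq E(S)$ such that $(M / C)|(E(S)\setminus C)$ has a restriction $S'$ that is a $(q,h,t)$-stack, and $X \setminus C$ and $E(S')$ are skew in $M / C$.
   Context: All matroids are finite. For a prime power $q$ and nonnegative integers $h,t$, a matroid $S$ is a $(q,h,t)$-stack if there are pairwise disjoint subsets $F_1,\dots,F_h$ of $E(S)$ whose union is spanning in $S$, such that for each $i \in \{1,\dots,h\}$ the matroid $(S/(F_1 \cup \dots \cup F_{i-1}))|F_i$ has rank at most $t$ and is not $\mathrm{GF}(q)$-representable. For $X,Y \subseteq E(M)$, the local connectivity is $\sqcap_M(X,Y) = r_M(X) + r_M(Y) - r_M(X \cup Y)$; $X$ and $Y$ are skew in $M$ if $\sqcap_M(X,Y)=0$. -}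

module Defs where

open import Level using (0ℓ)
open import Data.Nat using (ℕ; _∸_; _≤_)
import Data.Nat as Nat
open import Data.Nat.Primality using (Prime)
open import Data.Bool using (true; false)
open import Data.Fin using (Fin; zero; suc)
open import Data.Fin.Subset using (Subset; _⊆_; _∪_; _∩_; ⊥; ∣_∣; Empty; _∈_)
open import Data.Vec using ([]; _∷_)
open import Data.Product using (Σ; ∃; _×_; _,_)
open import Relation.Nullary using (¬_)
open import Relation.Binary.PropositionalEquality using (_≡_; _≢_)
import Relation.Binary.PropositionalEquality as ≡
open import Function using (_∘_)
open import Function.Bundles using (Inverse)
open import Algebra.Bundles using (CommutativeRing)

IsPrimePower : ℕ → Set
IsPrimePower q = Σ ℕ λ p → Σ ℕ λ k → Prime p × 1 ≤ k × q ≡ p Nat.^ k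

record Matroid (n : ℕ) : Set where
  field
    r     : Subset n → ℕ
    r-bnd : ∀ X → r X ≤ ∣ X ∣
    r-mon : ∀ X Y → X ⊆ Y → r X ≤ r Y
    r-sub : ∀ X Y → r (X ∪ Y) Nat.+ r (X ∩ Y) ≤ r X Nat.+ r Y
open Matroid public

-- rank function of the minor M / C (applied to sets disjoint from C)
mr : ∀ {n} → Matroid n → Subset n → Subset n → ℕ
mr M C Y = r M (Y ∪ C) ∸ r M C

lc : ∀ {n} → (Subset n → ℕ) → Subset n → Subset n → ℕ
lc ρ X Y = ρ X Nat.+ ρ Y ∸ ρ (X ∪ Y)

record Field : Set₁ where
  field
    ring  : CommutativeRing 0ℓ 0ℓ
  open CommutativeRing ring
  field
    nontrivial : ¬ (1# ≈ 0#)
    inverse    : ∀ x → ¬ (x ≈ 0#) → Σ Carrier λ y → (x * y) ≈ 1#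
open Field public

HasOrder : Field → ℕ → Set
HasOrder K q = Inverse (CommutativeRing.setoid (ring K)) (≡.setoid (Fin q))

module _ (K : Field) where
  open CommutativeRing (ring K) using (Carrier; _≈_; _+_; _*_; 0#)

  ssum : ∀ {n} → Subset n → (Fin n → Carrier) → Carrier
  ssum [] f = 0#
  ssum (true ∷ Y) f = f zero + ssum Y (f ∘ suc)
  ssum (false ∷ Y) f = ssum Y (f ∘ suc)

  LinIndep : ∀ {n k} → (Fin n → Fin k → Carrier) → Subset n → Set
  LinIndep {n} φ Y = ∀ (c : Fin n → Carrier) → (∀ j → ssum Y (λ e → c e * φ e j) ≈ 0#)
               → ∀ e → e ∈ Y → c e ≈ 0#

-- the minor (M / C) | F is GF(q)-representable: there is a field K with q
-- elements and vectors φ e ∈ K^k such that for every Y ⊆ F, Y is independent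
-- in (M / C) | F iff {φ e : e ∈ Y} is linearly independent.
Representable : ∀ {n} → ℕ → Matroid n → Subset n → Subset n → Set₁
Representable {n} q M C F =
  Σ Field λ K → HasOrder K q ×
  Σ ℕ λ k → Σ (Fin n → Fin k → CommutativeRing.Carrier (ring K)) λ φ →
  ∀ Y → Y ⊆ F → (mr M C Y ≡ ∣ Y ∣ → LinIndep K φ Y) × (LinIndep K φ Y → mr M C Y ≡ ∣ Y ∣)

prefix : ∀ {n h} → (Fin h → Subset n) → Fin h → Subset n
prefix F zero = ⊥
prefix F (suc i) = F zero ∪ prefix (F ∘ suc) i

union : ∀ {n h} → (Fin h → Subset n) → Subset n
union {h = Nat.zero} F = ⊥
union {h = Nat.suc h} F = F zero ∪ union (F ∘ suc)

-- The minor S = (M / C) | E is a (q,h,t)-stack.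
IsStack : ∀ {n} → ℕ → ℕ → ℕ → Matroid n → Subset n → Subset n → Set₁
IsStack {n} q h t M C E =
  Σ (Fin h → Subset n) λ F →
    (∀ i → F i ⊆ E)
  × (∀ i j → i ≢ j → Empty (F i ∩ F j))
  × (mr M C (union F) ≡ mr M C E)
  × (∀ i → mr M (C ∪ prefix F i) (F i) ≤ t)
  × (∀ i → ¬ Representable q M (C ∪ prefix F i) (F i))

-- Let f C = r (X ∪ C) − r C be the rank of X in M / C; it can only decrease as C grows, and
-- f ∅ = r X ≤ a + f U for the union U of the layers of S, by submodularity and because X and
-- E(S) ⊇ U have local connectivity at most a. Cut the (a+1)h layers of S into a+1
-- consecutive blocks of h layers and contract them one at a time. Contracting a block either
-- leaves f unchanged, in which case that block (a (q,h,t)-stack in the current minor) is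
-- skew to X, or lowers f by at least one; the latter can happen at most a times.
module Submission where

open import Data.Bool using (true; false)
open import Data.Empty using (⊥-elim)
open import Data.Fin using (Fin; zero; suc; _↑ˡ_; _↑ʳ_)
open import Data.Fin.Properties using (suc-injective; ↑ˡ-injective; ↑ʳ-injective)
open import Data.Fin.Subset using (Subset; _⊆_; _─_; ⊥; _∪_; _∩_; _∈_; _∉_; Empty)
open import Data.Fin.Subset.Properties
  using (x∈p∪q⁻; x∈p∩q⁺; p⊆p∪q; q⊆p∪q; ⊆-trans; ⊆-reflexive; ∉⊥; ⊆-min; ∣⊥∣≡0;
         x∈p∧x∉q⇒x∈p─q; ∪-assoc; ∪-comm; ∪-identityˡ; ∪-identityʳ)
open import Data.Nat using (ℕ; _≤_; _+_; _*_; _∸_; zero; suc; _≟_)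
open import Data.Nat.Properties
  using (≤-trans; ≤-antisym; ≤-pred; ≤∧≢⇒<; ≤-reflexive; n≤0⇒n≡0; n∸n≡0; +-comm;
         +-monoʳ-≤; +-monoˡ-≤; +-mono-≤; +-cancelʳ-≤; m≤n+m∸n; m+n≤o⇒m≤o∸n; +-∸-assoc;
         m∸n+n≡m; ∸-monoˡ-≤; ∸-+-assoc; [m+n]∸[m+o]≡n∸o; +-commutativeSemigroup;
         module ≤-Reasoning)
open import Algebra.Properties.CommutativeSemigroup +-commutativeSemigroup
  using (xy∙z≈x∙zy; x∙yz≈xz∙y; xy∙z≈yz∙x)
open import Data.Product using (Σ; ∃; _×_; _,_)
open import Data.Sum using (inj₁; inj₂)
open import Data.Vec using ([]; _∷_)
open import Function using (_∘_)
open import Relation.Binary.PropositionalEquality using (_≡_; _≢_; refl; sym; trans; cong; cong₂; subst; module ≡-Reasoning)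
open import Relation.Nullary using (¬_; yes; no)

open import Defs

∸-telescope : ∀ {c e u} → c ≤ e → e ≤ u → (u ∸ e) + (e ∸ c) ≡ u ∸ c
∸-telescope {c} {e} {u} c≤e e≤u =
  trans (sym (+-∸-assoc (u ∸ e) c≤e)) (cong (_∸ c) (m∸n+n≡m e≤u))

m+p≤n+o⇒m∸o≤n∸p : ∀ m n o p → m + p ≤ n + o → m ∸ o ≤ n ∸ p
m+p≤n+o⇒m∸o≤n∸p m n o p m+p≤n+o = begin
  m ∸ o               ≤⟨ ∸-monoˡ-≤ o (m+n≤o⇒m≤o∸n m m+p≤n+o) ⟩
  n + o ∸ p ∸ o       ≡⟨ ∸-+-assoc (n + o) p o ⟩
  n + o ∸ (p + o)     ≡⟨ cong₂ _∸_ (+-comm n o) (+-comm p o) ⟩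
  o + n ∸ (o + p)     ≡⟨ [m+n]∸[m+o]≡n∸o o n p ⟩
  n ∸ p               ∎
  where open ≤-Reasoning

+-exchange-≤ : ∀ x u e xe xu l → xe + u ≤ xu + e → x + e ≤ xe + l → x + u ≤ l + xu
+-exchange-≤ x u e xe xu l xe+u≤xu+e x+e≤xe+l = +-cancelʳ-≤ xe (x + u) (l + xu) (begin
  x + u + xe    ≡⟨ xy∙z≈x∙zy x u xe ⟩
  x + (xe + u)  ≤⟨ +-monoʳ-≤ x xe+u≤xu+e ⟩
  x + (xu + e)  ≡⟨ x∙yz≈xz∙y x xu e ⟩
  x + e + xu    ≤⟨ +-monoˡ-≤ xu x+e≤xe+l ⟩
  xe + l + xu   ≡⟨ xy∙z≈yz∙x xe l xu ⟩
  l + xu + xe   ∎)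
  where open ≤-Reasoning

∪-lub : ∀ {n} {A B C : Subset n} → A ⊆ C → B ⊆ C → A ∪ B ⊆ C
∪-lub {A = A} {B} A⊆C B⊆C x∈A∪B with x∈p∪q⁻ A B x∈A∪B
... | inj₁ x∈A = A⊆C x∈A
... | inj₂ x∈B = B⊆C x∈B

p─q∪q≡p∪q : ∀ {n} (X C : Subset n) → (X ─ C) ∪ C ≡ X ∪ C
p─q∪q≡p∪q []          []          = refl
p─q∪q≡p∪q (false ∷ X) (true ∷ C)  = cong (_ ∷_) (p─q∪q≡p∪q X C)
p─q∪q≡p∪q (true ∷ X)  (true ∷ C)  = cong (_ ∷_) (p─q∪q≡p∪q X C)
p─q∪q≡p∪q (false ∷ X) (false ∷ C) = cong (_ ∷_) (p─q∪q≡p∪q X C)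
p─q∪q≡p∪q (true ∷ X)  (false ∷ C) = cong (_ ∷_) (p─q∪q≡p∪q X C)

[p─q∪r]∪q≡p∪[q∪r] : ∀ {n} (X C E : Subset n) → ((X ─ C) ∪ E) ∪ C ≡ X ∪ (C ∪ E)
[p─q∪r]∪q≡p∪[q∪r] X C E = begin
  ((X ─ C) ∪ E) ∪ C ≡⟨ ∪-assoc (X ─ C) E C ⟩
  (X ─ C) ∪ (E ∪ C) ≡⟨ cong ((X ─ C) ∪_) (∪-comm E C) ⟩
  (X ─ C) ∪ (C ∪ E) ≡⟨ sym (∪-assoc (X ─ C) C E) ⟩
  ((X ─ C) ∪ C) ∪ E ≡⟨ cong (_∪ E) (p─q∪q≡p∪q X C) ⟩
  (X ∪ C) ∪ E       ≡⟨ ∪-assoc X C E ⟩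
  X ∪ (C ∪ E)       ∎
  where open ≡-Reasoning

module _ {n : ℕ} where

  union⁺ : ∀ {h} (F : Fin h → Subset n) i → F i ⊆ union F
  union⁺ F zero    = p⊆p∪q _
  union⁺ F (suc i) = ⊆-trans (union⁺ (F ∘ suc) i) (q⊆p∪q (F zero) _)

  union⁻ : ∀ {h} (F : Fin h → Subset n) {x} → x ∈ union F → ∃ λ i → x ∈ F i
  union⁻ {zero}  F x∈⊥ = ⊥-elim (∉⊥ x∈⊥)
  union⁻ {suc h} F x∈F with x∈p∪q⁻ (F zero) (union (F ∘ suc)) x∈F
  ... | inj₁ x∈F₀ = zero , x∈F₀
  ... | inj₂ x∈Fs with union⁻ (F ∘ suc) x∈Fs
  ...   | i , x∈Fᵢ = suc i , x∈Fᵢ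

  union-lub : ∀ {h} (F : Fin h → Subset n) {E} → (∀ i → F i ⊆ E) → union F ⊆ E
  union-lub F Fᵢ⊆E x∈F with union⁻ F x∈F
  ... | i , x∈Fᵢ = Fᵢ⊆E i x∈Fᵢ

  union-++ : ∀ h {m} (F : Fin (h + m) → Subset n) →
             union F ≡ union (F ∘ (_↑ˡ m)) ∪ union (F ∘ (h ↑ʳ_))
  union-++ zero    F = sym (∪-identityˡ _)
  union-++ (suc h) F = trans (cong (F zero ∪_) (union-++ h (F ∘ suc))) (sym (∪-assoc (F zero) _ _))

  ∪-union-++ : ∀ h {m} C (F : Fin (h + m) → Subset n) →
               C ∪ union F ≡ (C ∪ union (F ∘ (_↑ˡ m))) ∪ union (F ∘ (h ↑ʳ_))
  ∪-union-++ h C F = trans (cong (C ∪_) (union-++ h F)) (sym (∪-assoc C _ _))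

  prefix-↑ˡ : ∀ {h m} (F : Fin (h + m) → Subset n) (i : Fin h) →
              prefix F (i ↑ˡ m) ≡ prefix (F ∘ (_↑ˡ m)) i
  prefix-↑ˡ F zero    = refl
  prefix-↑ˡ F (suc i) = cong (F zero ∪_) (prefix-↑ˡ (F ∘ suc) i)

  prefix-↑ʳ : ∀ h {m} (F : Fin (h + m) → Subset n) (j : Fin m) →
              prefix F (h ↑ʳ j) ≡ union (F ∘ (_↑ˡ m)) ∪ prefix (F ∘ (h ↑ʳ_)) j
  prefix-↑ʳ zero    F j = sym (∪-identityˡ _)
  prefix-↑ʳ (suc h) F j = trans (cong (F zero ∪_) (prefix-↑ʳ h (F ∘ suc) j)) (sym (∪-assoc (F zero) _ _))

↑ʳ≢↑ˡ : ∀ {h m} (i : Fin h) (j : Fin m) → h ↑ʳ j ≢ i ↑ˡ m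
↑ʳ≢↑ˡ zero    j ()
↑ʳ≢↑ˡ (suc i) j eq = ↑ʳ≢↑ˡ i j (suc-injective eq)

module _ {n : ℕ} (M : Matroid n) where

  r-⊥ : r M ⊥ ≡ 0
  r-⊥ = n≤0⇒n≡0 (≤-trans (r-bnd M ⊥) (≤-reflexive (∣⊥∣≡0 n)))

  mr-⊥ : ∀ Y → mr M ⊥ Y ≡ r M Y
  mr-⊥ Y rewrite ∪-identityʳ Y | r-⊥ = refl

  r-diminishing-returns : ∀ X {C D} → C ⊆ D → r M (X ∪ D) + r M C ≤ r M (X ∪ C) + r M D
  r-diminishing-returns X {C} {D} C⊆D = ≤-trans
    (+-mono-≤ (r-mon M (X ∪ D) ((X ∪ C) ∪ D) X∪D⊆)
              (r-mon M C ((X ∪ C) ∩ D) (λ x∈C → x∈p∩q⁺ (q⊆p∪q X C x∈C , C⊆D x∈C))))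
    (r-sub M (X ∪ C) D)
    where
    X∪D⊆ : X ∪ D ⊆ (X ∪ C) ∪ D
    X∪D⊆ = ∪-lub (⊆-trans (p⊆p∪q C) (p⊆p∪q D)) (q⊆p∪q (X ∪ C) D)

  mr-antitone : ∀ X {C D} → C ⊆ D → mr M D X ≤ mr M C X
  mr-antitone X {C} {D} C⊆D =
    m+p≤n+o⇒m∸o≤n∸p (r M (X ∪ D)) (r M (X ∪ C)) (r M D) (r M C) (r-diminishing-returns X C⊆D)

  r≤lc+mr : ∀ X {U E} → U ⊆ E → r M X ≤ lc (r M) X E + mr M U X
  r≤lc+mr X {U} {E} U⊆E = begin
    r M X                              ≤⟨ m+n≤o⇒m≤o∸n (r M X) r[X]+r[U]≤ ⟩
    lc (r M) X E + r M (X ∪ U) ∸ r M U ≡⟨ +-∸-assoc (lc (r M) X E) (r-mon M U (X ∪ U) (q⊆p∪q X U)) ⟩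
    lc (r M) X E + mr M U X            ∎
    where
    open ≤-Reasoning
    r[X]+r[U]≤ : r M X + r M U ≤ lc (r M) X E + r M (X ∪ U)
    r[X]+r[U]≤ = +-exchange-≤ (r M X) (r M U) (r M E) (r M (X ∪ E)) (r M (X ∪ U)) (lc (r M) X E)
      (r-diminishing-returns X U⊆E) (m≤n+m∸n (r M X + r M E) (r M (X ∪ E)))

  skew-if-mr-stable : ∀ X C E → mr M C X ≡ mr M (C ∪ E) X → lc (mr M C) (X ─ C) E ≡ 0
  skew-if-mr-stable X C E stable
    rewrite [p─q∪r]∪q≡p∪[q∪r] X C E | p─q∪q≡p∪q X C | ∪-comm E C | stable =
    trans (cong (_∸ (u ∸ r M C)) (∸-telescope c≤e e≤u)) (n∸n≡0 (u ∸ r M C))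
    where
    u = r M (X ∪ (C ∪ E))
    c≤e : r M C ≤ r M (C ∪ E)
    c≤e = r-mon M C (C ∪ E) (p⊆p∪q E)
    e≤u : r M (C ∪ E) ≤ r M (X ∪ (C ∪ E))
    e≤u = r-mon M (C ∪ E) (X ∪ (C ∪ E)) (q⊆p∪q X (C ∪ E))

module _ (q t : ℕ) {n : ℕ} (M : Matroid n) (E : Subset n) where

  -- The layers of a stack in (M / C) | (E ∖ C), without the requirement that they span it.
  record StackLayers {k} (C : Subset n) (F : Fin k → Subset n) : Set₁ where
    field
      base⊆        : C ⊆ E
      layer⊆       : ∀ i → F i ⊆ E
      layer∉base   : ∀ i {x} → x ∈ F i → x ∉ C
      disjoint     : ∀ i j → i ≢ j → Empty (F i ∩ F j)
      layer-rank   : ∀ i → mr M (C ∪ prefix F i) (F i) ≤ t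
      layer-nonrep : ∀ i → ¬ Representable q M (C ∪ prefix F i) (F i)

  module _ h {m} {C : Subset n} {F : Fin (h + m) → Subset n} (L : StackLayers C F) where
    open StackLayers L

    take-isStack : IsStack q h t M C (union (F ∘ (_↑ˡ m)))
    take-isStack =
      F ∘ (_↑ˡ m) ,
      union⁺ (F ∘ (_↑ˡ m)) ,
      (λ i j i≢j → disjoint (i ↑ˡ m) (j ↑ˡ m) (i≢j ∘ ↑ˡ-injective m i j)) ,
      refl ,
      (λ i → subst (λ P → mr M (C ∪ P) (F (i ↑ˡ m)) ≤ t) (prefix-↑ˡ F i) (layer-rank (i ↑ˡ m))) ,
      (λ i → subst (λ P → ¬ Representable q M (C ∪ P) (F (i ↑ˡ m))) (prefix-↑ˡ F i)
                   (layer-nonrep (i ↑ˡ m)))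

    take⊆E─C : union (F ∘ (_↑ˡ m)) ⊆ E ─ C
    take⊆E─C x∈take with union⁻ (F ∘ (_↑ˡ m)) x∈take
    ... | i , x∈Fᵢ = x∈p∧x∉q⇒x∈p─q (layer⊆ (i ↑ˡ m) x∈Fᵢ) (layer∉base (i ↑ˡ m) x∈Fᵢ)

    drop-stackLayers : StackLayers (C ∪ union (F ∘ (_↑ˡ m))) (F ∘ (h ↑ʳ_))
    drop-stackLayers = record
      { base⊆        = ∪-lub base⊆ (union-lub (F ∘ (_↑ˡ m)) (layer⊆ ∘ (_↑ˡ m)))
      ; layer⊆       = layer⊆ ∘ (h ↑ʳ_)
      ; layer∉base   = layer∉C′
      ; disjoint     = λ i j i≢j → disjoint (h ↑ʳ i) (h ↑ʳ j) (i≢j ∘ ↑ʳ-injective h i j)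
      ; layer-rank   = λ j → subst (λ P → mr M P (F (h ↑ʳ j)) ≤ t) (base-↑ʳ j) (layer-rank (h ↑ʳ j))
      ; layer-nonrep = λ j → subst (λ P → ¬ Representable q M P (F (h ↑ʳ j))) (base-↑ʳ j)
                                   (layer-nonrep (h ↑ʳ j))
      }
      where
      base-↑ʳ : ∀ j → C ∪ prefix F (h ↑ʳ j) ≡ (C ∪ union (F ∘ (_↑ˡ m))) ∪ prefix (F ∘ (h ↑ʳ_)) j
      base-↑ʳ j = trans (cong (C ∪_) (prefix-↑ʳ h F j)) (sym (∪-assoc C _ _))

      layer∉C′ : ∀ j {x} → x ∈ F (h ↑ʳ j) → x ∉ C ∪ union (F ∘ (_↑ˡ m))
      layer∉C′ j {x} x∈Fⱼ x∈C′ with x∈p∪q⁻ C (union (F ∘ (_↑ˡ m))) x∈C′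
      ... | inj₁ x∈C    = layer∉base (h ↑ʳ j) x∈Fⱼ x∈C
      ... | inj₂ x∈take with union⁻ (F ∘ (_↑ˡ m)) x∈take
      ...   | i , x∈Fᵢ = disjoint (h ↑ʳ j) (i ↑ˡ m) (↑ʳ≢↑ˡ i j) (x , x∈p∩q⁺ (x∈Fⱼ , x∈Fᵢ))

  SkewSubstack : ℕ → Subset n → Set₁
  SkewSubstack h X =
    Σ (Subset n) λ C → C ⊆ E ×
      Σ (Subset n) λ E′ → E′ ⊆ (E ─ C) ×
        IsStack q h t M C E′ × lc (mr M C) (X ─ C) E′ ≡ 0

  skewSubstack-if-mr-stable : ∀ X h {m C} {F : Fin (h + m) → Subset n} → StackLayers C F →
    mr M C X ≡ mr M (C ∪ union (F ∘ (_↑ˡ m))) X → SkewSubstack h X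
  skewSubstack-if-mr-stable X h {m} {C} {F} L stable =
    C , StackLayers.base⊆ L , union (F ∘ (_↑ˡ m)) , take⊆E─C h L , take-isStack h L ,
    skew-if-mr-stable M X C (union (F ∘ (_↑ˡ m))) stable

  descent : ∀ X a h {C} (F : Fin ((a + 1) * h) → Subset n) → StackLayers C F →
            mr M C X ≤ a + mr M (C ∪ union F) X → SkewSubstack h X
  descent X zero h {C} F L bound = skewSubstack-if-mr-stable X h L
    (≤-antisym (≤-trans bound (mr-antitone M X C′⊆C∪F)) (mr-antitone M X (p⊆p∪q _)))
    where
    C′⊆C∪F : C ∪ union (F ∘ (_↑ˡ 0)) ⊆ C ∪ union F
    C′⊆C∪F = ⊆-trans (p⊆p∪q _) (⊆-reflexive (sym (∪-union-++ h C F)))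
  descent X (suc a) h {C} F L bound with mr M C X ≟ mr M (C ∪ union (F ∘ (_↑ˡ ((a + 1) * h)))) X
  ... | yes stable  = skewSubstack-if-mr-stable X h L stable
  ... | no unstable = descent X a h (F ∘ (h ↑ʳ_)) (drop-stackLayers h L) (≤-pred (begin-strict
    mr M C′ X                             <⟨ ≤∧≢⇒< (mr-antitone M X (p⊆p∪q _)) (unstable ∘ sym) ⟩
    mr M C X                              ≤⟨ bound ⟩
    suc a + mr M (C ∪ union F) X          ≡⟨ cong (λ D → suc a + mr M D X) (∪-union-++ h C F) ⟩
    suc a + mr M (C′ ∪ union (F ∘ (h ↑ʳ_))) X ∎))
    where
    open ≤-Reasoning
    C′ = C ∪ union (F ∘ (_↑ˡ ((a + 1) * h)))

lemma3p2 : (q a h t : ℕ) → IsPrimePower q → 1 ≤ h → 2 ≤ t →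
    ∀ {n} (M : Matroid n) (ES : Subset n) → IsStack q ((a + 1) * h) t M ⊥ ES →
    (X : Subset n) → lc (r M) X ES ≤ a →
    Σ (Subset n) λ C → C ⊆ ES ×
      Σ (Subset n) λ ES′ → ES′ ⊆ (ES ─ C) ×
        IsStack q h t M C ES′ × lc (mr M C) (X ─ C) ES′ ≡ 0
lemma3p2 q a h t _ _ _ M ES (F , layer⊆ , disjoint , _ , layer-rank , layer-nonrep) X lc≤a =
  descent q t M ES X a h F layers bound
  where
  open ≤-Reasoning
  layers : StackLayers q t M ES ⊥ F
  layers = record
    { base⊆ = ⊆-min ES ; layer⊆ = layer⊆ ; layer∉base = λ _ _ → ∉⊥ ; disjoint = disjoint
    ; layer-rank = layer-rank ; layer-nonrep = layer-nonrep }
  bound : mr M ⊥ X ≤ a + mr M (⊥ ∪ union F) X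
  bound = begin
    mr M ⊥ X                            ≡⟨ mr-⊥ M X ⟩
    r M X                               ≤⟨ r≤lc+mr M X (union-lub F layer⊆) ⟩
    lc (r M) X ES + mr M (union F) X    ≤⟨ +-monoˡ-≤ (mr M (union F) X) lc≤a ⟩
    a + mr M (union F) X                ≡⟨ cong (λ D → a + mr M D X) (sym (∪-identityˡ (union F))) ⟩
    a + mr M (⊥ ∪ union F) X            ∎
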